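{- Let $\mathcal{B}$ and $\mathcal{S}$ be collections of nonempty subsets of $\mathbb{R}^d$ and $q\in\mathbb{N}$. If the heterochromatic $(\aleph_0,q)$-theorem for $\mathcal{B}$ with respect to $\mathcal{S}$ holds, then the infinite heterochromatic $(\aleph_0,q)$-theorem for $\mathcal{B}$ with respect to $\mathcal{S}$ holds.
   Context: A family $\mathcal{F}\subseteq\mathcal{B}$ is finitely pierceable by $\mathcal{S}$ if there is a finite $S\subseteq\mathcal{S}$ with $\left(\bigcup_{A\in S}A\right)\cap B\ne\emptyset$ for all $B\in\mathcal{F}$. A sequence $\{B_n\}$ is a heterochromatic sequence of $\{\mathcal{F}_n\}_{n\in\mathbb{N}}$ if there is a strictly increasing sequence $\{i_n\}$ of naturals with $B_n\in\mathcal{F}_{i_n}$ for all $n$. A sequence $\{\mathcal{F}_n\}_{n\in\mathbb{N}}$ with $\mathcal{F}_n\subseteq\mathcal{B}$ has the heterochromatic $(\aleph_0,q)$-property with respect to $\mathcal{S}$ if for every heterochromatic sequence $\{B_n\}$ of $\{\mathcal{F}_n\}$ there is $A\in\mathcal{S}$ meeting $q$ distinct $B_n$'s. The heterochromatic $(\aleph_0,q)$-theorem for $\mathcal{B}$ with respect to $\mathcal{S}$ holds if for every such $\{\mathcal{F}_n\}$ ($\mathcal{F}_n\subseteq\mathcal{B}$) with the heterochromatic $(\aleph_0,q)$-property with respect to $\mathcal{S}$ there is some $n$ with $\mathcal{F}_n$ finitely pierceable by $\mathcal{S}$. The infinite heterochromatic $(\aleph_0,q)$-theorem for $\mathcal{B}$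 with respect to $\mathcal{S}$ holds if for every such $\{\mathcal{F}_n\}$ all but finitely many $\mathcal{F}_n$ are finitely pierceable by $\mathcal{S}$. -}

module Defs where

open import Level using (0ℓ)
open import Data.Nat using (ℕ; _<_; _≤_)
open import Data.Fin using (Fin)
open import Data.List using (List)
open import Data.List.Relation.Unary.All using (All)
open import Data.List.Relation.Unary.Any using (Any)
open import Data.Product using (Σ; ∃; _×_)
open import Function.Definitions using (Injective)
open import Relation.Binary.PropositionalEquality using (_≡_)

-- A subset of the ambient space X (X stands for ℝ^d).
Subset : Set → Set₁
Subset X = X → Set

Collection : Set → Set₁
Collection X = Subset X → Set

AllNonempty : {X : Set} → Collection X → Set₁
AllNonempty {X} 𝒞 = (A : Subset X) → 𝒞 A → ∃ λ x → A x

Meets : {X : Set} → Subset X → Subset X → Set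
Meets {X} A B = ∃ λ x → A x × B x

_⊆ᶜ_ : {X : Set} → Collection X → Collection X → Set₁
_⊆ᶜ_ {X} F G = (A : Subset X) → F A → G A

FinitelyPierceable : {X : Set} → Collection X → Collection X → Set₁
FinitelyPierceable {X} 𝒮 F =
  Σ (List (Subset X)) λ Ss →
    All 𝒮 Ss × ((B : Subset X) → F B → ∃ λ x → B x × Any (λ A → A x) Ss)

StrictlyIncreasing : (ℕ → ℕ) → Set
StrictlyIncreasing i = (m n : ℕ) → m < n → i m < i n

IsHeterochromatic : {X : Set} → (ℕ → Collection X) → (ℕ → Subset X) → Set
IsHeterochromatic F Bs =
  Σ (ℕ → ℕ) λ i → StrictlyIncreasing i × ((n : ℕ) → F (i n) (Bs n))

HetProperty : {X : Set} → Collection X → ℕ → (ℕ → Collection X) → Set₁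
HetProperty {X} 𝒮 q F =
  (Bs : ℕ → Subset X) → IsHeterochromatic F Bs →
    Σ (Subset X) λ A → 𝒮 A ×
      Σ (Fin q → ℕ) λ idx → Injective _≡_ _≡_ idx × ((k : Fin q) → Meets A (Bs (idx k)))

HetTheorem : {X : Set} → Collection X → Collection X → ℕ → Set₁
HetTheorem {X} ℬ 𝒮 q =
  (F : ℕ → Collection X) → ((n : ℕ) → F n ⊆ᶜ ℬ) → HetProperty 𝒮 q F →
    ∃ λ n → FinitelyPierceable 𝒮 (F n)

InfHetTheorem : {X : Set} → Collection X → Collection X → ℕ → Set₁
InfHetTheorem {X} ℬ 𝒮 q =
  (F : ℕ → Collection X) → ((n : ℕ) → F n ⊆ᶜ ℬ) → HetProperty 𝒮 q F →
    ∃ λ N → (n : ℕ) → N ≤ n → FinitelyPierceable 𝒮 (F n)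

{-# OPTIONS --safe #-}
-- If infinitely many F_n were not finitely pierceable, those F_n would form a
-- subsequence of {F_n}. Every heterochromatic sequence of a subsequence is one
-- of the whole sequence, so the subsequence inherits the heterochromatic
-- (ℵ₀,q)-property, and the (finite) heterochromatic theorem makes one of its
-- members finitely pierceable: a contradiction.
module Submission where

open import Defs
open import Level using (Level; suc; zero)
open import Data.Nat using (ℕ; _≤_; _<_; _<′_; ≤′-refl; ≤′-step)
open import Data.Nat.Properties using (<-trans; <⇒<′)
open import Data.Product using (Σ; ∃; ∃-syntax; _×_; _,_; proj₁; proj₂)
open import Function using (_∘_)
open import Relation.Nullary using (¬_)
open import Axiom.ExcludedMiddle using (ExcludedMiddle)
open import Axiom.DoubleNegationElimination using (DoubleNegationElimination; em⇒dne)

private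
  variable
    ℓ : Level

Eventually : (ℕ → Set ℓ) → Set ℓ
Eventually P = ∃ λ N → (n : ℕ) → N ≤ n → P n

Frequently : (ℕ → Set ℓ) → Set ℓ
Frequently P = (N : ℕ) → ∃[ n ] N ≤ n × P n

¬eventually⇒frequently¬ : DoubleNegationElimination ℓ → {P : ℕ → Set ℓ} →
                          ¬ Eventually P → Frequently (¬_ ∘ P)
¬eventually⇒frequently¬ dne ¬ev N =
  dne λ ¬fr → ¬ev (N , λ n N≤n → dne λ ¬Pn → ¬fr (n , N≤n , ¬Pn))

step⇒strictlyIncreasing : {j : ℕ → ℕ} → ((k : ℕ) → j k < j (ℕ.suc k)) →
                          StrictlyIncreasing j
step⇒strictlyIncreasing {j} step m n m<n = go (<⇒<′ m<n)
  where
  go : {n : ℕ} → m <′ n → j m < j n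
  go ≤′-refl         = step m
  go (≤′-step m<′n) = <-trans (go m<′n) (step _)

frequently⇒subsequence : {P : ℕ → Set ℓ} → Frequently P →
                         Σ (ℕ → ℕ) λ j → StrictlyIncreasing j × ((k : ℕ) → P (j k))
frequently⇒subsequence {P = P} fr = j , step⇒strictlyIncreasing j-step , P-j
  where
  j : ℕ → ℕ
  j ℕ.zero    = proj₁ (fr 0)
  j (ℕ.suc k) = proj₁ (fr (ℕ.suc (j k)))

  j-step : (k : ℕ) → j k < j (ℕ.suc k)
  j-step k = proj₁ (proj₂ (fr (ℕ.suc (j k))))

  P-j : (k : ℕ) → P (j k)
  P-j ℕ.zero    = proj₂ (proj₂ (fr 0))
  P-j (ℕ.suc k) = proj₂ (proj₂ (fr (ℕ.suc (j k))))

module _ {X : Set} {F : ℕ → Collection X} {j : ℕ → ℕ} (j↑ : StrictlyIncreasing j) where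

  IsHeterochromatic-subsequence : {Bs : ℕ → Subset X} →
                                  IsHeterochromatic (F ∘ j) Bs → IsHeterochromatic F Bs
  IsHeterochromatic-subsequence (i , i↑ , Bs∈) =
    j ∘ i , (λ m n m<n → j↑ (i m) (i n) (i↑ m n m<n)) , Bs∈

  HetProperty-subsequence : {𝒮 : Collection X} {q : ℕ} →
                            HetProperty 𝒮 q F → HetProperty 𝒮 q (F ∘ j)
  HetProperty-subsequence prop Bs = prop Bs ∘ IsHeterochromatic-subsequence

lemma1 : ExcludedMiddle (suc zero) →
    (X : Set) (ℬ 𝒮 : Collection X) (q : ℕ) →
    AllNonempty ℬ → AllNonempty 𝒮 →
    HetTheorem ℬ 𝒮 q → InfHetTheorem ℬ 𝒮 q
lemma1 em X ℬ 𝒮 q _ _ hetTheorem F F⊆ℬ prop = dne λ ¬cofinite →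
  let j , j↑ , unpierceable = frequently⇒subsequence
                                (¬eventually⇒frequently¬ dne ¬cofinite)
      k , pierceable        = hetTheorem (F ∘ j) (F⊆ℬ ∘ j)
                                (HetProperty-subsequence {F = F} j↑ prop)
  in unpierceable k pierceable
  where
  dne : DoubleNegationElimination (suc zero)
  dne = em⇒dne em
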